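{- Let $H$ be an instance as described in the context. Let $\mathcal{B}'=\{p^*_a : a\in\mathcal{A}\}$ and let $M$ match every agent $a$ to its most-preferred program among those in $\mathcal{B}'$ on its preference list. Then $M$ is stable.
   Context: An instance consists of a bipartite graph $(\mathcal{A}\cup\mathcal{B},E)$, agents $\mathcal{A}$, programs $\mathcal{B}$, $(a,p)\in E$ iff mutually acceptable; every agent has a non-empty preference list. Each agent and each program ranks its neighbours in a strict order ($y>_x z$: $x$ prefers $y$ to $z$). Each program $p$ has a non-negative integer cost $c(p)$; programs have no quotas. A matching $M\subseteq E$ assigns each agent to at most one program (a program may receive any number of agents); $M(a)$, $M(p)$ denote partners. A pair $(a,p)\in E\setminus M$ blocks $M$ if $p>_a M(a)$ and there is $a'\in M(p)$ with $a>_p a'$; $M$ is stable if no pair blocks it. For an agent $a$, $p^*_a$ is the program of minimum cost on $a$'s preference list, ties broken in favour of the program $a$ prefers most. -}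

module Defs where

open import Data.Nat using (ℕ; _<_)
open import Data.Fin using (Fin)
open import Data.List using (List; []; _∷_; _++_)
open import Data.List.Membership.Propositional using (_∈_)
open import Data.List.Relation.Unary.Unique.Propositional using (Unique)
open import Data.Product using (Σ; ∃; ∃₂; _×_)
open import Data.Sum using (_⊎_)
open import Relation.Binary.PropositionalEquality using (_≡_; _≢_)
open import Relation.Nullary using (¬_)

Before : {A : Set} → A → List A → A → Set
Before y l z = ∃₂ λ xs ys → (l ≡ xs ++ (y ∷ ys)) × (z ∈ ys)

-- Each agent/program has a
-- strict preference list (duplicate-free list, most preferred first) of its
-- neighbours; the edge set is given by mutual acceptability, which must be
-- consistent on both sides. Programs have
-- non-negative integer costs and no quotas.
record Instance (nA nB : ℕ) : Set where
  field
    aPref     : Fin nA → List (Fin nB)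
    pPref     : Fin nB → List (Fin nA)
    aUnique   : ∀ a → Unique (aPref a)
    pUnique   : ∀ p → Unique (pPref p)
    aNonEmpty : ∀ a → aPref a ≢ []
    edgeAP    : ∀ a p → p ∈ aPref a → a ∈ pPref p
    edgePA    : ∀ a p → a ∈ pPref p → p ∈ aPref a
    cost      : Fin nB → ℕ

module _ {nA nB : ℕ} (I : Instance nA nB) where
  open Instance I

  Edge : Fin nA → Fin nB → Set
  Edge a p = p ∈ aPref a

  AgentPrefers : Fin nA → Fin nB → Fin nB → Set
  AgentPrefers a y z = Before y (aPref a) z

  ProgPrefers : Fin nB → Fin nA → Fin nA → Set
  ProgPrefers p y z = Before y (pPref p) z

  IsPStar : Fin nA → Fin nB → Set
  IsPStar a p = Edge a p ×
    (∀ q → Edge a q → q ≢ p →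
       (cost p < cost q) ⊎ ((cost p ≡ cost q) × AgentPrefers a p q))

  InB' : Fin nB → Set
  InB' p = ∃ λ a → IsPStar a p

  IsMostPreferredInB' : (Fin nA → Fin nB) → Set
  IsMostPreferredInB' m = ∀ a →
    Edge a (m a) × InB' (m a) ×
    (∀ q → Edge a q → InB' q → q ≢ m a → AgentPrefers a (m a) q)

  Blocks : (Fin nA → Fin nB) → Fin nA → Fin nB → Set
  Blocks m a p = Edge a p × m a ≢ p × AgentPrefers a p (m a) ×
    (∃ λ a' → (m a' ≡ p) × ProgPrefers p a a')

  Stable : (Fin nA → Fin nB) → Set
  Stable m = ∀ a p → ¬ Blocks m a p

module Submission where

open import Defs
open import Data.Nat using (ℕ)
open import Data.Fin using (Fin)
open import Data.List using ([]; _∷_)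
open import Data.List.Properties using (∷-injective)
open import Data.List.Membership.Propositional using (_∈_)
open import Data.List.Membership.Propositional.Properties using (∈-++⁺ʳ)
open import Data.List.Relation.Unary.Any using (there)
open import Data.List.Relation.Unary.All using (lookup)
open import Data.List.Relation.Unary.AllPairs using (_∷_)
open import Data.List.Relation.Unary.Unique.Propositional using (Unique)
open import Data.Product using (_×_; _,_)
open import Data.Sum using (_⊎_; inj₁; inj₂)
open import Relation.Binary.PropositionalEquality using (_≡_; refl; sym; subst)
open import Relation.Nullary using (¬_)

-- If (a , p) blocked M, then p = M(a') for some a', so p ∈ B' and lies on a's
-- list; by the choice of M(a), agent a prefers M(a) to p, contradicting
-- p >_a M(a).

module _ {A : Set} where

  Before⇒∈ʳ : ∀ {x y : A} l → Before x l y → y ∈ l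
  Before⇒∈ʳ _ (xs , ys , refl , y∈ys) = ∈-++⁺ʳ xs (there y∈ys)

  Before-∷⁻ : ∀ {x y z : A} {l} → Before x (z ∷ l) y → (x ≡ z × y ∈ l) ⊎ Before x l y
  Before-∷⁻ ([]     , ys , refl , y∈ys) = inj₁ (refl , y∈ys)
  Before-∷⁻ (_ ∷ xs , ys , eq   , y∈ys) with ∷-injective eq
  ... | refl , refl = inj₂ (xs , ys , refl , y∈ys)

  Before-asym : ∀ {x y : A} l → Unique l → Before x l y → ¬ Before y l x
  Before-asym [] _ ([] , _ , () , _)
  Before-asym [] _ (_ ∷ _ , _ , () , _)
  Before-asym (z ∷ l) (z∉l ∷ u) x<y y<x with Before-∷⁻ x<y | Before-∷⁻ y<x
  ... | inj₁ (refl , y∈l) | inj₁ (refl , _)   = lookup z∉l y∈l refl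
  ... | inj₁ (refl , _)   | inj₂ y<x′         = lookup z∉l (Before⇒∈ʳ l y<x′) refl
  ... | inj₂ x<y′         | inj₁ (refl , _)   = lookup z∉l (Before⇒∈ʳ l x<y′) refl
  ... | inj₂ x<y′         | inj₂ y<x′         = Before-asym l u x<y′ y<x′

module _ {nA nB : ℕ} (I : Instance nA nB) where
  open Instance I

  AgentPrefers-asym : ∀ a {p q} → AgentPrefers I a p q → ¬ AgentPrefers I a q p
  AgentPrefers-asym a = Before-asym (aPref a) (aUnique a)

  assigned-InB' : ∀ {m} → IsMostPreferredInB' I m → ∀ a → InB' I (m a)
  assigned-InB' M a with M a
  ... | _ , inB' , _ = inB'

lemma6 : (nA nB : ℕ) (I : Instance nA nB) (m : Fin nA → Fin nB) →
    IsMostPreferredInB' I m → Stable I m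
lemma6 nA nB I m M a p (e , m-a≢p , p>m-a , a' , m-a'≡p , _) with M a
... | _ , _ , best =
  AgentPrefers-asym I a p>m-a
    (best p e (subst (InB' I) m-a'≡p (assigned-InB' I M a')) (λ p≡m-a → m-a≢p (sym p≡m-a)))
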